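{- Let $k\geq 2$ and let $G$ be a graph having an ear with at least $2k$ vertices. Suppose $G$ has a $k$-role colouring whose role graph $R$ is connected. Then $R\in\{C_k,P_k,P_k^*,P_k^{**}\}$ (up to renaming colours).
   Context: Graphs are finite, undirected, without multiple edges, possibly with loops. An ear of $G$ is a set of vertices each of degree $2$ in $G$ which induces a path. A role colouring of $G$ is a map $r:V(G)\to\mathbb{N}^+$ such that $r(u)=r(v)$ implies $\{r(u'):u'\in N(u)\}=\{r(v'):v'\in N(v)\}$; it is a $k$-role colouring if exactly $k$ colours are used. Its role graph is the graph on the set of used colours with an edge $\{x,y\}$ (possibly a loop) whenever some vertex of colour $x$ has a neighbour of colour $y$. $P_k$ has vertex set $\{1,\ldots,k\}$ and edges $\{i,i+1\}$, $1\le i<k$; $C_k$ is $P_k$ plus the edge $\{k,1\}$; $P_k^*$ is $P_k$ plus a loop at $k$; $P_k^{**}$ is $P_k$ plus loops at $1$ and $k$. -}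

module Defs where

open import Data.Nat using (ℕ; zero; suc; _+_; _≤_; _*_)
open import Data.Fin using (Fin; toℕ)
open import Data.Fin.Properties using (_≟_)
open import Data.Bool using (Bool; true; false; T; if_then_else_)
open import Data.List using (List; map; allFin)
open import Data.Nat.ListAction using (sum)
open import Data.Product using (Σ; ∃; _×_; _,_)
open import Data.Sum using (_⊎_)
open import Relation.Binary.PropositionalEquality using (_≡_)
open import Relation.Nullary using (does)
open import Function.Bundles using (_⇔_; _↔_; Inverse)
open import Function.Definitions using (Injective; Surjective)

-- A finite undirected graph without multiple edges, loops allowed:
-- vertex set Fin n, symmetric Boolean adjacency (adj v v = true means a loop at v).
record Graph : Set where
  field
    n   : ℕ
    adj : Fin n → Fin n → Bool
    sym : ∀ u v → adj u v ≡ adj v u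

module _ (G : Graph) where
  open Graph G

  Adj : Fin n → Fin n → Set
  Adj u v = T (adj u v)

  degree : Fin n → ℕ
  degree v = sum (map w (allFin n))
    where
    w : Fin n → ℕ
    w u = if adj v u then (if does (u ≟ v) then 2 else 1) else 0

  IsEar : (m : ℕ) → (Fin m → Fin n) → Set
  IsEar m p =
    Injective _≡_ _≡_ p
    × (∀ i → degree (p i) ≡ 2)
    × (∀ i j → Adj (p i) (p j) ⇔ (toℕ j ≡ suc (toℕ i) ⊎ toℕ i ≡ suc (toℕ j)))

  HasEarWithAtLeast : ℕ → Set
  HasEarWithAtLeast s = Σ ℕ λ m → s ≤ m × Σ (Fin m → Fin n) λ p → IsEar m p

  -- A k-role colouring, with the k used colours named 0,…,k-1 (surjective onto Fin k).
  IsRoleColouring : (k : ℕ) → (Fin n → Fin k) → Set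
  IsRoleColouring k r =
    Surjective _≡_ _≡_ r
    × (∀ u v → r u ≡ r v → ∀ c →
         (∃ λ u' → Adj u u' × r u' ≡ c) ⇔ (∃ λ v' → Adj v v' × r v' ≡ c))

  RoleEdge : (k : ℕ) → (Fin n → Fin k) → Fin k → Fin k → Set
  RoleEdge k r x y = ∃ λ u → ∃ λ v → r u ≡ x × r v ≡ y × Adj u v

data Reach {k : ℕ} (E : Fin k → Fin k → Set) : Fin k → Fin k → Set where
  here : ∀ {x} → Reach E x x
  step : ∀ {x y z} → E x y → Reach E y z → Reach E x z

Connected : {k : ℕ} → (Fin k → Fin k → Set) → Set
Connected E = ∀ x y → Reach E x y

-- Model graphs on vertex set Fin k, vertex i here corresponds to i+1 in the paper.
PathE : (k : ℕ) → Fin k → Fin k → Set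
PathE k i j = toℕ j ≡ suc (toℕ i) ⊎ toℕ i ≡ suc (toℕ j)

CycleE : (k : ℕ) → Fin k → Fin k → Set
CycleE k i j = PathE k i j
  ⊎ (toℕ i ≡ 0 × suc (toℕ j) ≡ k) ⊎ (toℕ j ≡ 0 × suc (toℕ i) ≡ k)

Path*E : (k : ℕ) → Fin k → Fin k → Set
Path*E k i j = PathE k i j ⊎ (suc (toℕ i) ≡ k × suc (toℕ j) ≡ k)

Path**E : (k : ℕ) → Fin k → Fin k → Set
Path**E k i j = PathE k i j ⊎ (suc (toℕ i) ≡ k × suc (toℕ j) ≡ k)
  ⊎ (toℕ i ≡ 0 × toℕ j ≡ 0)

Iso : {k : ℕ} → (Fin k → Fin k → Set) → (Fin k → Fin k → Set) → Set
Iso {k} E F = Σ (Fin k ↔ Fin k) λ σ →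
  ∀ x y → E x y ⇔ F (Inverse.to σ x) (Inverse.to σ y)

module Submission where

-- Read the colours w 0, w 1, …, w (m-1) along an ear with
-- m ≥ 2k vertices.  Every ear vertex has degree 2, so by the role condition each
-- inner colour w (t+1) has no role-neighbours besides w t and w (t+2), and the last
-- one has at most two.  Such a walk in the connected role graph R contains a window
-- of k distinct consecutive colours: a shorter segment that repeats a colour and
-- contains the neighbours of its first colour would be closed under R, hence would
-- contain all k colours.  Scanning from position 1, either k distinct colours follow
-- at once, or the first repetition exhibits a loop or a backtrack, i.e. a turning
-- position from which k distinct colours follow.  Numbering the colours along the
-- window, R contains the path P_k, its inner vertices have no further neighbours,
-- and its two ends have at most one further neighbour each; so R is C_k or P_k with
-- loops at some ends (P_k with a loop at the first end only is P_k^* backwards).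

open import Defs
open import Data.Nat using (ℕ; zero; suc; _+_; _∸_; _*_; _≤_; _<_; z≤n; s≤s)
open import Data.Nat.Properties
open import Data.Nat.ListAction using (sum)
open import Data.Fin using (Fin; toℕ; fromℕ; fromℕ<; punchOut; opposite)
  renaming (zero to fzero; suc to fsuc)
open import Data.Fin.Properties
  using ( toℕ-injective; toℕ-fromℕ; toℕ-fromℕ<; fromℕ<-cong; toℕ<n; injective⇒≤
        ; punchOut-injective; punchIn-punchOut; opposite-prop; opposite-involutive; any?)
  renaming (_≟_ to _≟ᶠ_)
open import Data.Vec.Functional using (removeAt)
open import Algebra.Properties.CommutativeMonoid.Sum +-0-commutativeMonoid
  using (sum-remove) renaming (sum to ∑)
open import Data.Bool using (true; false; T; if_then_else_)
open import Data.List using (map; allFin; tabulate)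
open import Data.List.Properties using (map-tabulate)
open import Data.Product using (∃; _×_; _,_; proj₁; proj₂)
open import Data.Sum using (_⊎_; inj₁; inj₂; [_,_]′; swap)
open import Data.Empty using (⊥; ⊥-elim)
open import Relation.Nullary using (¬_; Dec; yes; no; does; contradiction)
open import Relation.Nullary.Decidable using (_×-dec_; ¬?; T?; decidable-stable)
open import Relation.Binary.PropositionalEquality
open import Function using (_∘_; id)
open import Function.Bundles using (_⇔_; mk⇔; mk↔ₛ′; Equivalence)
open import Function.Definitions using (Injective)
open import Function.Properties.Equivalence using () renaming (trans to ⇔-trans)

open Equivalence using (to; from)

-- A surjection Fin L → Fin k forces k ≤ L: choosing preimages gives an injection back.
surjective⇒≤ : ∀ {L k} (f : Fin L → Fin k) → (∀ y → ∃ λ a → f a ≡ y) → k ≤ L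
surjective⇒≤ f preimage = injective⇒≤ {f = proj₁ ∘ preimage} λ {x} {y} same →
  trans (sym (proj₂ (preimage x))) (trans (cong f same) (proj₂ (preimage y)))

-- An injective self-map of Fin k is onto: if it missed y, punching y out of
-- its values would give an injection Fin k → Fin (k - 1).
injective⇒surjective : ∀ {k} (f : Fin k → Fin k) → Injective _≡_ _≡_ f
  → ∀ y → ∃ λ a → f a ≡ y
injective⇒surjective {suc K} f f-inj y with any? (λ a → f a ≟ᶠ y)
... | yes hit = hit
... | no miss = contradiction (injective⇒≤ {f = squeeze} squeeze-inj) 1+n≰n
  where
  avoids : ∀ a → y ≢ f a
  avoids a y≡fa = miss (a , sym y≡fa)
  squeeze : Fin (suc K) → Fin K
  squeeze a = punchOut (avoids a)
  squeeze-inj : Injective _≡_ _≡_ squeeze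
  squeeze-inj same = f-inj (punchOut-injective (avoids _) (avoids _) same)

iso-from-injection : ∀ {k} {R F : Fin k → Fin k → Set} (σ : Fin k → Fin k)
  → Injective _≡_ _≡_ σ → (∀ s t → R (σ s) (σ t) ⇔ F s t) → Iso R F
iso-from-injection {k} {R} σ σ-inj pullback = mk↔ₛ′ τ σ τσ στ , λ x y → mk⇔
    (λ r → to (pullback (τ x) (τ y)) (subst₂ R (sym (στ x)) (sym (στ y)) r))
    (λ f → subst₂ R (στ x) (στ y) (from (pullback (τ x) (τ y)) f))
  where
  τ : Fin k → Fin k
  τ x = proj₁ (injective⇒surjective σ σ-inj x)
  στ : ∀ x → σ (τ x) ≡ x
  στ x = proj₂ (injective⇒surjective σ σ-inj x)
  τσ : ∀ s → τ (σ s) ≡ s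
  τσ s = σ-inj (στ (σ s))

sum-allFin : ∀ {n} (f : Fin n → ℕ) → sum (map f (allFin n)) ≡ ∑ f
sum-allFin f = trans (cong sum (map-tabulate id f)) (sum-tabulate f)
  where
  sum-tabulate : ∀ {n} (f : Fin n → ℕ) → sum (tabulate f) ≡ ∑ f
  sum-tabulate {zero} f = refl
  sum-tabulate {suc n} f = cong (f fzero +_) (sum-tabulate (f ∘ fsuc))

entry≤∑ : ∀ {n} (g : Fin n → ℕ) a → g a ≤ ∑ g
entry≤∑ {suc n} g a = subst (g a ≤_) (sym (sum-remove {i = a} g)) (m≤m+n _ _)

pair≤∑ : ∀ {n} (g : Fin n → ℕ) {a b} → a ≢ b → g a + g b ≤ ∑ g
pair≤∑ {suc n} g {a} {b} a≢b = begin
  g a + g b                         ≡⟨ cong (λ x → g a + g x) (sym (punchIn-punchOut a≢b)) ⟩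
  g a + removeAt g a (punchOut a≢b) ≤⟨ +-monoʳ-≤ (g a) (entry≤∑ (removeAt g a) _) ⟩
  g a + ∑ (removeAt g a)            ≡⟨ sym (sum-remove g) ⟩
  ∑ g                               ∎
  where open ≤-Reasoning

triple≤∑ : ∀ {n} (g : Fin n → ℕ) {a b c} → a ≢ b → a ≢ c → b ≢ c → g a + (g b + g c) ≤ ∑ g
triple≤∑ {suc n} g {a} {b} {c} a≢b a≢c b≢c = begin
  g a + (g b + g c)                 ≡⟨ cong₂ (λ x y → g a + (g x + g y))
                                         (sym (punchIn-punchOut a≢b)) (sym (punchIn-punchOut a≢c)) ⟩
  g a + (h (punchOut a≢b) + h (punchOut a≢c))
                                    ≤⟨ +-monoʳ-≤ (g a) (pair≤∑ h b′≢c′) ⟩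
  g a + ∑ h                         ≡⟨ sym (sum-remove g) ⟩
  ∑ g                               ∎
  where
  open ≤-Reasoning
  h : Fin n → ℕ
  h = removeAt g a
  b′≢c′ : punchOut a≢b ≢ punchOut a≢c
  b′≢c′ same = b≢c (punchOut-injective a≢b a≢c same)

module DegreeTwo (G : Graph) where
  open Graph G using (n; adj)

  weight : Fin n → Fin n → ℕ
  weight v u = if adj v u then (if does (u ≟ᶠ v) then 2 else 1) else 0

  degree≡∑ : ∀ v → degree G v ≡ ∑ (weight v)
  degree≡∑ v = sum-allFin (weight v)

  neighbour-weight : ∀ v u → Adj G v u → 1 ≤ weight v u
  neighbour-weight v u vu with adj v u | does (u ≟ᶠ v)
  ... | true  | true  = s≤s z≤n
  ... | true  | false = s≤s z≤n
  ... | false | _     = ⊥-elim vu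

  no-three-neighbours : ∀ {v a b c} → degree G v ≡ 2 → a ≢ b → a ≢ c → b ≢ c
    → Adj G v a → Adj G v b → Adj G v c → ⊥
  no-three-neighbours {v} {a} {b} {c} deg a≢b a≢c b≢c va vb vc = 1+n≰n (begin
    3                                       ≤⟨ +-mono-≤ (neighbour-weight v a va)
                                                 (+-mono-≤ (neighbour-weight v b vb) (neighbour-weight v c vc)) ⟩
    weight v a + (weight v b + weight v c)  ≤⟨ triple≤∑ (weight v) a≢b a≢c b≢c ⟩
    ∑ (weight v)                            ≡⟨ sym (degree≡∑ v) ⟩
    degree G v                              ≡⟨ deg ⟩
    2                                       ∎)
    where open ≤-Reasoning

  only-neighbours : ∀ {v a b} → degree G v ≡ 2 → a ≢ b → Adj G v a → Adj G v b
    → ∀ u → Adj G v u → u ≡ a ⊎ u ≡ b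
  only-neighbours {a = a} {b} deg a≢b va vb u vu with u ≟ᶠ a | u ≟ᶠ b
  ... | yes u≡a | _       = inj₁ u≡a
  ... | no _    | yes u≡b = inj₂ u≡b
  ... | no u≢a  | no u≢b  = ⊥-elim (no-three-neighbours deg a≢b (u≢a ∘ sym) (u≢b ∘ sym) va vb vu)

  other-neighbour : ∀ {v a} → degree G v ≡ 2 → Adj G v a
    → ∃ λ z → ∀ u → Adj G v u → u ≡ a ⊎ u ≡ z
  other-neighbour {v} {a} deg va with any? (λ z → T? (adj v z) ×-dec ¬? (z ≟ᶠ a))
  ... | yes (z , vz , z≢a) = z , only-neighbours deg (z≢a ∘ sym) va vz
  ... | no none = a , λ u vu → inj₁ (decidable-stable (u ≟ᶠ a) (λ u≢a → none (u , vu , u≢a)))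

role-edge-sym : ∀ G {k r x y} → RoleEdge G k r x y → RoleEdge G k r y x
role-edge-sym G (u , v , ru , rv , uv) = v , u , rv , ru , subst T (Graph.sym G u v) uv

role-edge-dec : ∀ G {k} r x y → Dec (RoleEdge G k r x y)
role-edge-dec G r x y =
  any? λ u → any? λ v → (r u ≟ᶠ x) ×-dec (r v ≟ᶠ y) ×-dec T? (Graph.adj G u v)

role-neighbours-within : ∀ G {k r} → IsRoleColouring G k r
  → ∀ v a b → (∀ u → Adj G v u → u ≡ a ⊎ u ≡ b)
  → ∀ y → RoleEdge G k r (r v) y → y ≡ r a ⊎ y ≡ r b
role-neighbours-within G (_ , same-role) v a b within y (u , u′ , ru , ru′ , uu′)
  with to (same-role u v ru y) (u′ , uu′ , ru′)
... | v′ , vv′ , rv′≡y with within v′ vv′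
...   | inj₁ refl = inj₁ (sym rv′≡y)
...   | inj₂ refl = inj₂ (sym rv′≡y)

closed⇒all : ∀ {k} {R : Fin k → Fin k → Set} → Connected R → (S : Fin k → Set)
  → (∀ {x y} → S x → R x y → S y) → ∀ {x} → S x → ∀ y → S y
closed⇒all {R = R} connected S closed {x} Sx y = along (connected x y) Sx
  where
  along : ∀ {x y} → Reach R x y → S x → S y
  along here        Sx = Sx
  along (step xy p) Sx = along p (closed Sx xy)

Distinct : ∀ {k} → (ℕ → Fin k) → ℕ → ℕ → Set
Distinct w i L = ∀ a b → a < L → b < L → w (a + i) ≡ w (b + i) → a ≡ b

module Walk {k : ℕ} (R : Fin k → Fin k → Set) (R-sym : ∀ {x y} → R x y → R y x)
  (connected : Connected R) (m : ℕ) (w : ℕ → Fin k)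
  (consecutive : ∀ t → suc t < m → R (w t) (w (suc t)))
  (inner : ∀ t → suc (suc t) < m → ∀ y → R (w (suc t)) y → y ≡ w t ⊎ y ≡ w (suc (suc t)))
  where

  Seg : ℕ → ℕ → Fin k → Set
  Seg i L y = ∃ λ j → j < L × w (j + i) ≡ y

  seg? : ∀ i L y → Dec (Seg i L y)
  seg? i L y = anyUpTo? (λ j → w (j + i) ≟ᶠ y) L

  -- a segment closed under R holds all k colours, so it is at least k long
  closed-segment-long : ∀ i L → 0 < L → (∀ {x y} → Seg i L x → R x y → Seg i L y) → k ≤ L
  closed-segment-long i L 0<L closed = surjective⇒≤ (λ a → w (toℕ a + i)) onto
    where
    onto : ∀ y → ∃ λ a → w (toℕ a + i) ≡ y
    onto y with closed⇒all connected (Seg i L) closed (0 , 0<L , refl) y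
    ... | j , j<L , wj≡y = fromℕ< j<L , trans (cong (λ j → w (j + i)) (toℕ-fromℕ< j<L)) wj≡y

  seg-upto : ∀ {i L} → Seg i L (w (L + i)) → ∀ j → j ≤ L → Seg i L (w (j + i))
  seg-upto next j j≤L with m≤n⇒m<n∨m≡n j≤L
  ... | inj₁ j<L  = j , j<L , refl
  ... | inj₂ refl = next

  -- A segment that contains its successor colour and the R-neighbours of its first
  -- colour is closed under R, because its other colours sit at inner positions.
  wrapping-segment-long : ∀ i L → 0 < L → L + i < m → Seg i L (w (L + i))
    → (∀ y → R (w i) y → Seg i L y) → k ≤ L
  wrapping-segment-long i L 0<L L+i<m next first = closed-segment-long i L 0<L closed
    where
    closed : ∀ {x y} → Seg i L x → R x y → Seg i L y
    closed (zero , _ , refl) r = first _ r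
    closed (suc a , a+2≤L , refl) r
      with inner (a + i) (≤-<-trans (+-monoˡ-≤ i a+2≤L) L+i<m) _ r
    ... | inj₁ refl = a , ≤-trans (n≤1+n _) a+2≤L , refl
    ... | inj₂ refl = seg-upto next (suc (suc a)) a+2≤L

  extend : ∀ {i L} → Distinct w i L → ¬ Seg i L (w (L + i)) → Distinct w i (suc L)
  extend D fresh a b a≤L b≤L same with m<1+n⇒m<n∨m≡n a≤L | m<1+n⇒m<n∨m≡n b≤L
  ... | inj₁ a<L  | inj₁ b<L  = D a b a<L b<L same
  ... | inj₂ refl | inj₂ refl = refl
  ... | inj₂ refl | inj₁ b<L  = ⊥-elim (fresh (b , b<L , sym same))
  ... | inj₁ a<L  | inj₂ refl = ⊥-elim (fresh (a , a<L , same))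

  first-repetition : ∀ i L
    → Distinct w i L ⊎ ∃ λ L′ → L′ < L × Distinct w i L′ × Seg i L′ (w (L′ + i))
  first-repetition i zero = inj₁ λ _ _ ()
  first-repetition i (suc L) with first-repetition i L
  ... | inj₂ (L′ , L′<L , D , rep) = inj₂ (L′ , m<n⇒m<1+n L′<L , D , rep)
  ... | inj₁ D with seg? i L (w (L + i))
  ...   | yes rep   = inj₂ (L , n<1+n L , D , rep)
  ...   | no  fresh = inj₁ (extend D fresh)

  TurnsAt : ℕ → Set
  TurnsAt e = ∀ y → R (w e) y → y ≡ w e ⊎ y ≡ w (suc e)

  turn : ∀ t → suc (suc t) < m → w t ≡ w (suc t) ⊎ w t ≡ w (suc (suc t)) → TurnsAt (suc t)
  turn t bound turning y r with inner t bound y r | turning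
  ... | inj₂ y≡next | _          = inj₂ y≡next
  ... | inj₁ y≡wt   | inj₁ loop  = inj₁ (trans y≡wt loop)
  ... | inj₁ y≡wt   | inj₂ back  = inj₂ (trans y≡wt back)

  distinct-after-turn : ∀ e → k + e ≤ m → TurnsAt e → Distinct w e k
  distinct-after-turn e k+e≤m turns with first-repetition e k
  ... | inj₁ D = D
  ... | inj₂ (L , L<k , _ , rep@(j , j<L , _)) =
    contradiction (wrapping-segment-long e L 0<L (≤-trans (+-monoˡ-< e L<k) k+e≤m) rep first) (<⇒≱ L<k)
    where
    0<L : 0 < L
    0<L = ≤-trans (s≤s z≤n) j<L
    first : ∀ y → R (w e) y → Seg e L y
    first y r with turns y r
    ... | inj₁ refl = seg-upto rep 0 z≤n
    ... | inj₂ refl = seg-upto rep 1 0<L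

  -- At the first repetition w (L + 1) = w (l + 1) (offsets l < L),
  -- the colour at offset L - 1 is an R-neighbour of the one at offset l.  It is not the
  -- colour before offset l: that is excluded by distinctness, or for l = 0 by the
  -- segment avoiding w 0 (otherwise the segment wraps around).  So it is the colour at
  -- offset l + 1, which yields a loop or a backtrack at position l + 1.
  turn-or-distinct : k + 1 < m → Distinct w 1 k ⊎ ∃ λ e → suc e ≤ k × TurnsAt (suc e)
  turn-or-distinct room = scan (first-repetition 1 k)
    where
    on-walk : ∀ j → j ≤ k → j + 1 < m
    on-walk j j≤k = ≤-<-trans (+-monoˡ-≤ 1 j≤k) room

    before : ℕ → ℕ
    before zero    = 0
    before (suc l) = l + 1

    around : ∀ l → suc l ≤ k → ∀ y → R (w (l + 1)) y → y ≡ w (before l) ⊎ y ≡ w (suc l + 1)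
    around zero    l<k = inner 0 (on-walk 1 l<k)
    around (suc l) l<k = inner (l + 1) (on-walk (suc (suc l)) l<k)

    turning-at : ∀ l → suc (suc l) ≤ k → w (l + 1) ≡ w (suc l + 1) ⊎ w (l + 1) ≡ w (suc (suc l) + 1)
      → ∃ λ e → suc e ≤ k × TurnsAt (suc e)
    turning-at l l+2≤k turning =
      l + 1 , subst (_≤ k) (cong suc (sym (+-comm l 1))) l+2≤k
            , turn (l + 1) (on-walk (suc (suc l)) l+2≤k) turning

    scan : Distinct w 1 k ⊎ (∃ λ L → L < k × Distinct w 1 L × Seg 1 L (w (L + 1)))
      → Distinct w 1 k ⊎ ∃ λ e → suc e ≤ k × TurnsAt (suc e)
    scan (inj₁ D) = inj₁ D
    scan (inj₂ (zero , _ , _ , (_ , () , _)))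
    scan (inj₂ (suc L′ , L<k , D , rep@(l , l<L , wl≡wL))) with seg? 1 (suc L′) (w 0)
    ... | yes w0∈ = contradiction (wrapping-segment-long 1 (suc L′) (s≤s z≤n) (on-walk (suc L′) (<⇒≤ L<k)) rep first) (<⇒≱ L<k)
      where
      first : ∀ y → R (w 1) y → Seg 1 (suc L′) y
      first y r with around 0 (≤-trans (s≤s z≤n) L<k) y r
      ... | inj₁ refl = w0∈
      ... | inj₂ refl = seg-upto rep 1 (s≤s z≤n)
    ... | no w0∉ with around l (≤-trans l<L (<⇒≤ L<k)) (w (L′ + 1))
                        (subst (λ x → R x (w (L′ + 1))) (sym wl≡wL)
                          (R-sym (consecutive (L′ + 1) (on-walk (suc L′) (<⇒≤ L<k)))))
    ...   | inj₁ is-before = ⊥-elim (not-before l l<L is-before)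
      where
      not-before : ∀ l → l < suc L′ → w (L′ + 1) ≢ w (before l)
      not-before zero    _   same = w0∉ (L′ , ≤-refl , same)
      not-before (suc l) l<L same = <-irrefl (cong suc (sym (D L′ l ≤-refl (<-trans (n<1+n l) l<L) same))) l<L
    ...   | inj₂ is-after with m≤n⇒m<n∨m≡n l<L
    ...     | inj₂ refl      = inj₂ (turning-at l L<k (inj₁ is-after))
    ...     | inj₁ l+1<L with D L′ (suc l) ≤-refl l+1<L is-after
    ...       | refl = inj₂ (turning-at l (≤-trans l+1<L (<⇒≤ L<k)) (inj₂ wl≡wL))

  window : k + 1 < m → k + k ≤ m → ∃ λ i → k + suc i ≤ m × Distinct w (suc i) k
  window room long with turn-or-distinct room
  ... | inj₁ D = 0 , <⇒≤ room , D
  ... | inj₂ (e , e<k , turns) = e , fits , distinct-after-turn (suc e) fits turns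
    where
    fits : k + suc e ≤ m
    fits = ≤-trans (+-monoʳ-≤ k e<k) long

_≐_ : ∀ {k} → (Fin k → Fin k → Set) → (Fin k → Fin k → Set) → Set
E ≐ F = ∀ s t → E s t ⇔ F s t

-- P_k with a loop at its first vertex (that is, P_k^* read backwards)
FirstLoopE : (k : ℕ) → Fin k → Fin k → Set
FirstLoopE k s t = PathE k s t ⊎ (toℕ s ≡ 0 × toℕ t ≡ 0)

Shape : ∀ {k} → (Fin k → Fin k → Set) → Set
Shape {k} E = E ≐ CycleE k ⊎ E ≐ PathE k ⊎ E ≐ Path*E k ⊎ E ≐ Path**E k ⊎ E ≐ FirstLoopE k

mirror-succ : ∀ {K a a′ b b′} → a′ + a ≡ K → b′ + b ≡ K → b′ ≡ suc a′ → a ≡ suc b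
mirror-succ {K} {a} {a′} {b} a′+a b′+b refl = +-cancelˡ-≡ a′ a (suc b) (begin
  a′ + a       ≡⟨ a′+a ⟩
  K            ≡⟨ sym b′+b ⟩
  suc (a′ + b) ≡⟨ sym (+-suc a′ b) ⟩
  a′ + suc b   ∎)
  where open ≡-Reasoning

mirror-path : ∀ {K a a′ b b′} → a′ + a ≡ K → b′ + b ≡ K
  → b′ ≡ suc a′ ⊎ a′ ≡ suc b′ → b ≡ suc a ⊎ a ≡ suc b
mirror-path a′+a b′+b (inj₁ b′≡a′+1) = inj₂ (mirror-succ a′+a b′+b b′≡a′+1)
mirror-path a′+a b′+b (inj₂ a′≡b′+1) = inj₁ (mirror-succ b′+b a′+a a′≡b′+1)

mirror-zero : ∀ {K a a′} → a′ + a ≡ K → a′ ≡ 0 → a ≡ K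
mirror-zero a′+a refl = a′+a

mirror-end : ∀ {K a a′} → a′ + a ≡ K → a ≡ K → a′ ≡ 0
mirror-end {a = a} {a′} a′+a refl = +-cancelʳ-≡ a a′ 0 a′+a

opposite-mirror : ∀ {K} (s : Fin (suc K)) → toℕ (opposite s) + toℕ s ≡ K
opposite-mirror {K} s = begin
  toℕ (opposite s) + toℕ s ≡⟨ cong (_+ toℕ s) (opposite-prop s) ⟩
  K ∸ toℕ s + toℕ s        ≡⟨ m∸n+n≡m (≤-pred (toℕ<n s)) ⟩
  K                        ∎
  where open ≡-Reasoning

reverse-first-loop : ∀ {K} (s t : Fin (suc K)) → FirstLoopE (suc K) (opposite s) (opposite t) ⇔ Path*E (suc K) s t
reverse-first-loop s t = mk⇔
  [ inj₁ ∘ mirror-path s′+s t′+t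
  , (λ (s′≡0 , t′≡0) → inj₂ (cong suc (mirror-zero s′+s s′≡0) , cong suc (mirror-zero t′+t t′≡0))) ]′
  [ inj₁ ∘ mirror-path (trans (+-comm (toℕ s) _) s′+s) (trans (+-comm (toℕ t) _) t′+t)
  , (λ (sK , tK) → inj₂ (mirror-end s′+s (suc-injective sK) , mirror-end t′+t (suc-injective tK))) ]′
  where
  s′+s = opposite-mirror s
  t′+t = opposite-mirror t

shape⇒iso : ∀ {K} {R : Fin (suc K) → Fin (suc K) → Set} (σ : Fin (suc K) → Fin (suc K))
  → Injective _≡_ _≡_ σ → Shape (λ s t → R (σ s) (σ t))
  → Iso R (CycleE (suc K)) ⊎ Iso R (PathE (suc K)) ⊎ Iso R (Path*E (suc K)) ⊎ Iso R (Path**E (suc K))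
shape⇒iso σ σ-inj (inj₁ cycle)                       = inj₁ (iso-from-injection σ σ-inj cycle)
shape⇒iso σ σ-inj (inj₂ (inj₁ path))                = inj₂ (inj₁ (iso-from-injection σ σ-inj path))
shape⇒iso σ σ-inj (inj₂ (inj₂ (inj₁ last-loop)))    = inj₂ (inj₂ (inj₁ (iso-from-injection σ σ-inj last-loop)))
shape⇒iso σ σ-inj (inj₂ (inj₂ (inj₂ (inj₁ loops)))) = inj₂ (inj₂ (inj₂ (iso-from-injection σ σ-inj loops)))
shape⇒iso σ σ-inj (inj₂ (inj₂ (inj₂ (inj₂ first-loop)))) =
  inj₂ (inj₂ (inj₁ (iso-from-injection (σ ∘ opposite) (opposite-injective ∘ σ-inj)
    λ s t → ⇔-trans (first-loop (opposite s) (opposite t)) (reverse-first-loop s t))))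
  where
  opposite-injective : ∀ {s t} → opposite s ≡ opposite t → s ≡ t
  opposite-injective {s} {t} same =
    trans (sym (opposite-involutive s)) (trans (cong opposite same) (opposite-involutive t))

module PathShape (J : ℕ) (E : Fin (suc (suc J)) → Fin (suc (suc J)) → Set)
  (E-sym : ∀ {s t} → E s t → E t s) (E-dec : ∀ s t → Dec (E s t))
  (E-path : ∀ s t → PathE (suc (suc J)) s t → E s t)
  (E-inner : ∀ s t a → toℕ s ≡ suc a → suc (suc a) < suc (suc J) → E s t → PathE (suc (suc J)) s t)
  (first-nbrs : ∃ λ x → ∀ t → E fzero t → toℕ t ≡ 1 ⊎ t ≡ x)
  (last-nbrs : ∃ λ x → ∀ t → E (fromℕ (suc J)) t → toℕ t ≡ J ⊎ t ≡ x)
  where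

  k : ℕ
  k = suc (suc J)

  first last : Fin k
  first = fzero
  last  = fromℕ (suc J)

  IsFirst IsLast End : Fin k → Set
  IsFirst s = toℕ s ≡ 0
  IsLast  s = suc (toℕ s) ≡ k
  End     s = IsFirst s ⊎ IsLast s

  first-unique : ∀ {s} → IsFirst s → s ≡ first
  first-unique = toℕ-injective

  last-unique : ∀ {s} → IsLast s → s ≡ last
  last-unique sK = toℕ-injective (trans (suc-injective sK) (sym (toℕ-fromℕ (suc J))))

  first≢last : first ≢ last
  first≢last same = 0≢1+n (trans (cong toℕ same) (toℕ-fromℕ (suc J)))

  at : ∀ {s t s′ t′} → s ≡ s′ → t ≡ t′ → E s t → E s′ t′
  at = subst₂ E

  end-or-inner : ∀ s → End s ⊎ ∃ λ a → toℕ s ≡ suc a × suc (suc a) < k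
  end-or-inner s = by-index (toℕ s) refl (toℕ<n s)
    where
    by-index : ∀ j → toℕ s ≡ j → j < k → End s ⊎ ∃ λ a → toℕ s ≡ suc a × suc (suc a) < k
    by-index zero    s≡0   _     = inj₁ (inj₁ s≡0)
    by-index (suc a) s≡a+1 a+1<k with m≤n⇒m<n∨m≡n (≤-pred a+1<k)
    ... | inj₁ a+1<J+1 = inj₂ (a , s≡a+1 , s≤s a+1<J+1)
    ... | inj₂ a≡J     = inj₁ (inj₂ (cong suc (trans s≡a+1 a≡J)))

  path-or-ends : ∀ {s t} → E s t → PathE k s t ⊎ (End s × End t)
  path-or-ends {s} {t} st with end-or-inner s | end-or-inner t
  ... | inj₂ (a , s≡a+1 , a+2<k) | _ = inj₁ (E-inner s t a s≡a+1 a+2<k st)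
  ... | inj₁ _ | inj₂ (a , t≡a+1 , a+2<k) = inj₁ (swap (E-inner t s a t≡a+1 a+2<k (E-sym st)))
  ... | inj₁ s-end | inj₁ t-end = inj₂ (s-end , t-end)

  -- A chord between the ends (with J ≥ 1) uses up the second neighbour of both
  -- ends, so there are no loops and E is the cycle.
  module Chord (chord : E first last) (J≢0 : J ≢ 0) where
    no-first-loop : ¬ E first first
    no-first-loop loop with proj₂ first-nbrs last chord | proj₂ first-nbrs first loop
    ... | inj₁ last≡1 | _            = J≢0 (suc-injective (trans (sym (toℕ-fromℕ (suc J))) last≡1))
    ... | inj₂ _      | inj₁ ()
    ... | inj₂ last≡x | inj₂ first≡x = first≢last (trans first≡x (sym last≡x))

    no-last-loop : ¬ E last last
    no-last-loop loop with proj₂ last-nbrs first (E-sym chord) | proj₂ last-nbrs last loop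
    ... | inj₁ 0≡J     | _           = J≢0 (sym 0≡J)
    ... | inj₂ _       | inj₁ last≡J = 1+n≢n (trans (sym (toℕ-fromℕ (suc J))) last≡J)
    ... | inj₂ first≡x | inj₂ last≡x = first≢last (trans first≡x (sym last≡x))

    cycle : E ≐ CycleE k
    cycle s t = mk⇔ to-cycle from-cycle
      where
      to-cycle : E s t → CycleE k s t
      to-cycle st with path-or-ends st
      ... | inj₁ p                  = inj₁ p
      ... | inj₂ (inj₁ s0 , inj₁ t0) = ⊥-elim (no-first-loop (at (first-unique s0) (first-unique t0) st))
      ... | inj₂ (inj₂ sK , inj₂ tK) = ⊥-elim (no-last-loop (at (last-unique sK) (last-unique tK) st))
      ... | inj₂ (inj₁ s0 , inj₂ tK) = inj₂ (inj₁ (s0 , tK))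
      ... | inj₂ (inj₂ sK , inj₁ t0) = inj₂ (inj₂ (t0 , sK))
      from-cycle : CycleE k s t → E s t
      from-cycle (inj₁ p)                  = E-path s t p
      from-cycle (inj₂ (inj₁ (s0 , tK)))  = at (sym (first-unique s0)) (sym (last-unique tK)) chord
      from-cycle (inj₂ (inj₂ (t0 , sK)))  = at (sym (last-unique sK)) (sym (first-unique t0)) (E-sym chord)

  module NoChord (no-chord : ¬ E first last ⊎ J ≡ 0) where
    ends-adjacent : ∀ {s t} → IsFirst s → IsLast t → E s t → toℕ t ≡ suc (toℕ s)
    ends-adjacent {s} {t} s0 tK st = [ no-edge , adjacent ]′ no-chord
      where
      no-edge : ¬ E first last → toℕ t ≡ suc (toℕ s)
      no-edge ¬chord = ⊥-elim (¬chord (at (first-unique s0) (last-unique tK) st))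
      adjacent : J ≡ 0 → toℕ t ≡ suc (toℕ s)
      adjacent J≡0 = begin
        toℕ t       ≡⟨ suc-injective tK ⟩
        suc J       ≡⟨ cong suc J≡0 ⟩
        1           ≡⟨ cong suc (sym s0) ⟩
        suc (toℕ s) ∎
        where open ≡-Reasoning

    edge-kinds : ∀ {s t} → E s t
      → PathE k s t ⊎ (IsFirst s × IsFirst t × E first first) ⊎ (IsLast s × IsLast t × E last last)
    edge-kinds st with path-or-ends st
    ... | inj₁ p                  = inj₁ p
    ... | inj₂ (inj₁ s0 , inj₁ t0) = inj₂ (inj₁ (s0 , t0 , at (first-unique s0) (first-unique t0) st))
    ... | inj₂ (inj₂ sK , inj₂ tK) = inj₂ (inj₂ (sK , tK , at (last-unique sK) (last-unique tK) st))
    ... | inj₂ (inj₁ s0 , inj₂ tK) = inj₁ (inj₁ (ends-adjacent s0 tK st))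
    ... | inj₂ (inj₂ sK , inj₁ t0) = inj₁ (inj₂ (ends-adjacent t0 sK (E-sym st)))

    loop-first : E first first → ∀ {s t} → IsFirst s → IsFirst t → E s t
    loop-first l0 s0 t0 = at (sym (first-unique s0)) (sym (first-unique t0)) l0

    loop-last : E last last → ∀ {s t} → IsLast s → IsLast t → E s t
    loop-last lK sK tK = at (sym (last-unique sK)) (sym (last-unique tK)) lK

    plain : ¬ E first first → ¬ E last last → E ≐ PathE k
    plain ¬l0 ¬lK s t = mk⇔
      (λ st → [ (λ p → p)
              , [ (λ (_ , _ , l0) → ⊥-elim (¬l0 l0)) , (λ (_ , _ , lK) → ⊥-elim (¬lK lK)) ]′ ]′ (edge-kinds st))
      (E-path s t)

    loop-at-last : ¬ E first first → E last last → E ≐ Path*E k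
    loop-at-last ¬l0 lK s t = mk⇔
      (λ st → [ inj₁
              , [ (λ (_ , _ , l0) → ⊥-elim (¬l0 l0)) , (λ (sK , tK , _) → inj₂ (sK , tK)) ]′ ]′ (edge-kinds st))
      [ E-path s t , (λ (sK , tK) → loop-last lK sK tK) ]′

    loops-at-both : E first first → E last last → E ≐ Path**E k
    loops-at-both l0 lK s t = mk⇔
      (λ st → [ inj₁
              , [ (λ (s0 , t0 , _) → inj₂ (inj₂ (s0 , t0))) , (λ (sK , tK , _) → inj₂ (inj₁ (sK , tK))) ]′ ]′
              (edge-kinds st))
      [ E-path s t , [ (λ (sK , tK) → loop-last lK sK tK) , (λ (s0 , t0) → loop-first l0 s0 t0) ]′ ]′

    loop-at-first : E first first → ¬ E last last → E ≐ FirstLoopE k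
    loop-at-first l0 ¬lK s t = mk⇔
      (λ st → [ inj₁
              , [ (λ (s0 , t0 , _) → inj₂ (s0 , t0)) , (λ (_ , _ , lK) → ⊥-elim (¬lK lK)) ]′ ]′ (edge-kinds st))
      [ E-path s t , (λ (s0 , t0) → loop-first l0 s0 t0) ]′

    loops : Shape E
    loops with E-dec first first | E-dec last last
    ... | no ¬l0 | no ¬lK = inj₂ (inj₁ (plain ¬l0 ¬lK))
    ... | no ¬l0 | yes lK = inj₂ (inj₂ (inj₁ (loop-at-last ¬l0 lK)))
    ... | yes l0 | yes lK = inj₂ (inj₂ (inj₂ (inj₁ (loops-at-both l0 lK))))
    ... | yes l0 | no ¬lK = inj₂ (inj₂ (inj₂ (inj₂ (loop-at-first l0 ¬lK))))

  shape : Shape E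
  shape with J ≟ 0 | E-dec first last
  ... | yes J≡0 | _         = NoChord.loops (inj₂ J≡0)
  ... | no _    | no ¬chord = NoChord.loops (inj₁ ¬chord)
  ... | no J≢0  | yes chord = inj₁ (Chord.cycle chord J≢0)

module Window {J : ℕ} (R : Fin (suc (suc J)) → Fin (suc (suc J)) → Set)
  (R-sym : ∀ {x y} → R x y → R y x) (R-dec : ∀ x y → Dec (R x y))
  (m : ℕ) (w : ℕ → Fin (suc (suc J)))
  (consecutive : ∀ t → suc t < m → R (w t) (w (suc t)))
  (inner : ∀ t → suc (suc t) < m → ∀ y → R (w (suc t)) y → y ≡ w t ⊎ y ≡ w (suc (suc t)))
  (outer : ∀ t → suc t < m → ∃ λ z → ∀ y → R (w (suc t)) y → y ≡ w t ⊎ y ≡ z)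
  (i : ℕ) (fits : suc (suc J) + suc i ≤ m) (distinct : Distinct w (suc i) (suc (suc J)))
  where

  k : ℕ
  k = suc (suc J)

  σ : Fin k → Fin k
  σ a = w (toℕ a + suc i)

  σ-injective : Injective _≡_ _≡_ σ
  σ-injective same = toℕ-injective (distinct _ _ (toℕ<n _) (toℕ<n _) same)

  preimage : Fin k → Fin k
  preimage y = proj₁ (injective⇒surjective σ σ-injective y)

  named : ∀ {t y} → σ t ≡ y → t ≡ preimage y
  named {y = y} σt≡y = σ-injective (trans σt≡y (sym (proj₂ (injective⇒surjective σ σ-injective y))))

  E : Fin k → Fin k → Set
  E s t = R (σ s) (σ t)

  on-ear : ∀ j → j < k → j + suc i < m
  on-ear j j<k = <-≤-trans (+-monoˡ-< (suc i) j<k) fits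

  E-path : ∀ s t → PathE k s t → E s t
  E-path s t (inj₁ t≡s+1) = forward s t t≡s+1
    where
    forward : ∀ s t → toℕ t ≡ suc (toℕ s) → E s t
    forward s t t≡s+1 = subst (λ j → R (σ s) (w (j + suc i))) (sym t≡s+1)
      (consecutive (toℕ s + suc i) (on-ear (suc (toℕ s)) (subst (_< k) t≡s+1 (toℕ<n t))))
  E-path s t (inj₂ s≡t+1) = R-sym (E-path t s (inj₁ s≡t+1))

  E-inner : ∀ s t a → toℕ s ≡ suc a → suc (suc a) < k → E s t → PathE k s t
  E-inner s t a s≡a+1 a+2<k st
    with inner (a + suc i) (on-ear (suc (suc a)) a+2<k) (σ t) (subst (λ j → R (w (j + suc i)) (σ t)) s≡a+1 st)
  ... | inj₁ at-a  = inj₂ (trans s≡a+1 (cong suc (sym (distinct _ _ (toℕ<n t) a<k at-a))))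
    where
    a<k : a < k
    a<k = <-trans (m<n⇒m<1+n (n<1+n a)) a+2<k
  ... | inj₂ at-a+2 = inj₁ (trans (distinct _ _ (toℕ<n t) a+2<k at-a+2) (cong suc (sym s≡a+1)))

  first-nbrs : ∃ λ x → ∀ t → E fzero t → toℕ t ≡ 1 ⊎ t ≡ x
  first-nbrs = preimage (w i) , only
    where
    only : ∀ t → E fzero t → toℕ t ≡ 1 ⊎ t ≡ preimage (w i)
    only t st with inner i (on-ear 1 (s≤s (s≤s z≤n))) (σ t) st
    ... | inj₁ at-i    = inj₂ (named at-i)
    ... | inj₂ at-next = inj₁ (distinct _ _ (toℕ<n t) (s≤s (s≤s z≤n)) at-next)

  last-nbrs : ∃ λ x → ∀ t → E (fromℕ (suc J)) t → toℕ t ≡ J ⊎ t ≡ x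
  last-nbrs with outer (J + suc i) (on-ear (suc J) ≤-refl)
  ... | z , within = preimage z , only
    where
    only : ∀ t → E (fromℕ (suc J)) t → toℕ t ≡ J ⊎ t ≡ preimage z
    only t st with within (σ t) (subst (λ j → R (w (j + suc i)) (σ t)) (toℕ-fromℕ (suc J)) st)
    ... | inj₁ at-J = inj₁ (distinct _ _ (toℕ<n t) (m<n⇒m<1+n (n<1+n J)) at-J)
    ... | inj₂ at-z = inj₂ (named at-z)

  isomorphism : Iso R (CycleE k) ⊎ Iso R (PathE k) ⊎ Iso R (Path*E k) ⊎ Iso R (Path**E k)
  isomorphism = shape⇒iso σ σ-injective
    (PathShape.shape J E R-sym (λ s t → R-dec (σ s) (σ t)) E-path E-inner first-nbrs last-nbrs)

module EarColours (G : Graph) {k : ℕ} {r : Fin (Graph.n G) → Fin k} (rc : IsRoleColouring G k r)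
  {m : ℕ} {p : Fin m → Fin (Graph.n G)} (ear : IsEar G m p) (nonempty : 0 < m)
  where
  open Graph G using (n)
  open DegreeTwo G using (only-neighbours; other-neighbour)

  -- the t-th ear vertex (for t ≥ m, a fixed ear vertex stands in)
  vertex : ℕ → Fin n
  vertex t with t <? m
  ... | yes t<m = p (fromℕ< t<m)
  ... | no  _   = p (fromℕ< nonempty)

  vertex-on-ear : ∀ t (t<m : t < m) → vertex t ≡ p (fromℕ< t<m)
  vertex-on-ear t t<m with t <? m
  ... | yes t<m′ = cong p (fromℕ<-cong t t refl t<m′ t<m)
  ... | no  t≮m  = contradiction t<m t≮m

  vertex-injective : ∀ {t s} → t < m → s < m → vertex t ≡ vertex s → t ≡ s
  vertex-injective {t} {s} t<m s<m same = begin
    t                     ≡⟨ sym (toℕ-fromℕ< t<m) ⟩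
    toℕ (fromℕ< t<m)      ≡⟨ cong toℕ (proj₁ ear (trans (sym (vertex-on-ear t t<m)) (trans same (vertex-on-ear s s<m)))) ⟩
    toℕ (fromℕ< s<m)      ≡⟨ toℕ-fromℕ< s<m ⟩
    s                     ∎
    where open ≡-Reasoning

  vertex-degree : ∀ t → t < m → degree G (vertex t) ≡ 2
  vertex-degree t t<m = subst (λ v → degree G v ≡ 2) (sym (vertex-on-ear t t<m)) (proj₁ (proj₂ ear) _)

  forward : ∀ t → suc t < m → Adj G (vertex t) (vertex (suc t))
  forward t t+1<m = subst₂ (Adj G) (sym (vertex-on-ear t t<m)) (sym (vertex-on-ear (suc t) t+1<m))
    (from (proj₂ (proj₂ ear) (fromℕ< t<m) (fromℕ< t+1<m))
      (inj₁ (trans (toℕ-fromℕ< t+1<m) (cong suc (sym (toℕ-fromℕ< t<m))))))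
    where
    t<m : t < m
    t<m = <-trans (n<1+n t) t+1<m

  backward : ∀ t → suc t < m → Adj G (vertex (suc t)) (vertex t)
  backward t t+1<m = subst T (Graph.sym G _ _) (forward t t+1<m)

  w : ℕ → Fin k
  w t = r (vertex t)

  consecutive : ∀ t → suc t < m → RoleEdge G k r (w t) (w (suc t))
  consecutive t t+1<m = vertex t , vertex (suc t) , refl , refl , forward t t+1<m

  inner : ∀ t → suc (suc t) < m → ∀ y → RoleEdge G k r (w (suc t)) y → y ≡ w t ⊎ y ≡ w (suc (suc t))
  inner t t+2<m = role-neighbours-within G rc (vertex (suc t)) (vertex t) (vertex (suc (suc t)))
    (only-neighbours (vertex-degree (suc t) t+1<m) ends-differ (backward t t+1<m) (forward (suc t) t+2<m))
    where
    t+1<m : suc t < m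
    t+1<m = <-trans (n<1+n _) t+2<m
    ends-differ : vertex t ≢ vertex (suc (suc t))
    ends-differ same = <⇒≢ (m<n⇒m<1+n (n<1+n t)) (vertex-injective (<-trans (n<1+n t) t+1<m) t+2<m same)

  outer : ∀ t → suc t < m → ∃ λ z → ∀ y → RoleEdge G k r (w (suc t)) y → y ≡ w t ⊎ y ≡ z
  outer t t+1<m with other-neighbour (vertex-degree (suc t) t+1<m) (backward t t+1<m)
  ... | z , within = r z , role-neighbours-within G rc (vertex (suc t)) (vertex t) z within

lemma2 : (k : ℕ) → 2 ≤ k → (G : Graph) → HasEarWithAtLeast G (2 * k)
    → (r : Fin (Graph.n G) → Fin k) → IsRoleColouring G k r
    → Connected (RoleEdge G k r)
    → Iso (RoleEdge G k r) (CycleE k) ⊎ Iso (RoleEdge G k r) (PathE k)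
    ⊎ Iso (RoleEdge G k r) (Path*E k) ⊎ Iso (RoleEdge G k r) (Path**E k)
lemma2 k@(suc (suc J)) 2≤k@(s≤s (s≤s z≤n)) G (m , 2k≤m , p , ear) r rc connected =
  let (i , fits , distinct) = Walk.window R (role-edge-sym G) connected m w consecutive inner room long
  in Window.isomorphism R (role-edge-sym G) (role-edge-dec G r) m w consecutive inner outer i fits distinct
  where
  R : Fin k → Fin k → Set
  R = RoleEdge G k r
  long : k + k ≤ m
  long = subst (_≤ m) (cong (k +_) (+-identityʳ k)) 2k≤m
  room : k + 1 < m
  room = <-≤-trans (+-monoʳ-< k 2≤k) long
  open EarColours G rc ear (≤-trans (s≤s z≤n) long)
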